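{- Let $G$ be a simple graph with $n$ vertices and $m$ edges, where $m\ge n-1$, and let $k$ be an integer with $3\leq k\leq n$. If $\lambda_k(G)=\lfloor\frac{2m}{n}\rfloor$, then (1) $\frac{2m}{n}$ is not an integer; (2) $\delta(G)=\lfloor\frac{2m}{n}\rfloor$; (3) for any $u,v\in V(G)$ with $d_G(u)=d_G(v)=\lfloor\frac{2m}{n}\rfloor$, $uv\notin E(G)$.
   Context: All graphs are finite, simple and undirected. For a graph $G$ and a vertex set $S\subseteq V(G)$ with $|S|\ge 2$, an $S$-Steiner tree is a subgraph of $G$ which is a tree and contains every vertex of $S$. $\lambda(S)$ denotes the maximum number of pairwise edge-disjoint $S$-Steiner trees in $G$. For an integer $k$ with $2\le k\le |V(G)|$, the generalized $k$-edge-connectivity is $\lambda_k(G)=\min\{\lambda(S): S\subseteq V(G),\ |S|=k\}$, with the convention $\lambda_k(G)=0$ if $G$ is disconnected. $\delta(G)$ is the minimum degree and $d_G(u)$ the degree of $u$. -}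

module Defs where

open import Data.Nat using (ℕ; zero; suc; _+_; _*_; _≤_; _<ᵇ_)
open import Data.Bool using (Bool; true; false; if_then_else_; _∧_)
open import Data.Fin using (Fin; toℕ)
open import Data.Fin.Subset using (Subset; _∈_; ∣_∣)
open import Data.List using (List; []; _∷_; _++_; [_]; length; map; allFin)
open import Data.Nat.ListAction using (sum)
open import Data.List.Relation.Unary.Unique.Propositional using (Unique)
open import Data.Product using (Σ; _×_; ∃)
open import Data.Unit using (⊤)
open import Relation.Binary.PropositionalEquality using (_≡_; _≢_)
open import Relation.Nullary using (¬_)

record Graph (n : ℕ) : Set where
  field
    adj     : Fin n → Fin n → Bool
    sym     : ∀ u v → adj u v ≡ adj v u
    irrefl  : ∀ u → adj u u ≡ false
open Graph public

EdgeSet : ℕ → Set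
EdgeSet n = Fin n → Fin n → Bool

count : ∀ {n} → (Fin n → Bool) → ℕ
count {n} p = sum (map (λ j → if p j then 1 else 0) (allFin n))

deg : ∀ {n} → Graph n → Fin n → ℕ
deg G u = count (adj G u)

numEdges : ∀ {n} → Graph n → ℕ
numEdges {n} G = sum (map (λ u → count (λ v → adj G u v ∧ (toℕ u <ᵇ toℕ v))) (allFin n))

MinDegreeIs : ∀ {n} → Graph n → ℕ → Set
MinDegreeIs G d = (∀ u → d ≤ deg G u) × ∃ (λ u → deg G u ≡ d)

data Walk {n} (F : EdgeSet n) : Fin n → Fin n → Set where
  here : ∀ {u} → Walk F u u
  step : ∀ {u v w} → F u v ≡ true → Walk F v w → Walk F u w

Path : ∀ {n} → EdgeSet n → List (Fin n) → Set
Path F [] = ⊤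
Path F (x ∷ []) = ⊤
Path F (x ∷ y ∷ r) = (F x y ≡ true) × Path F (y ∷ r)

HasCycle : ∀ {n} → EdgeSet n → Set
HasCycle {n} F = Σ (Fin n) λ v → Σ (List (Fin n)) λ vs →
  (2 ≤ length vs) × Unique (v ∷ vs) × Path F (v ∷ vs ++ [ v ])

record SubTree {n} (G : Graph n) : Set where
  field
    verts     : Subset n
    edges     : EdgeSet n
    edgesSym  : ∀ u v → edges u v ≡ edges v u
    edgesSub  : ∀ u v → edges u v ≡ true → adj G u v ≡ true
    edgesIn   : ∀ u v → edges u v ≡ true → (u ∈ verts) × (v ∈ verts)
    nonempty  : ∃ λ u → u ∈ verts
    connected : ∀ u v → u ∈ verts → v ∈ verts → Walk edges u v
    acyclic   : ¬ HasCycle edges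
open SubTree public

record SteinerTree {n} (G : Graph n) (S : Subset n) : Set where
  field
    tree     : SubTree G
    contains : ∀ u → u ∈ S → u ∈ verts tree
open SteinerTree public

HasDisjointTrees : ∀ {n} → Graph n → Subset n → ℕ → Set
HasDisjointTrees {n} G S t =
  Σ (Fin t → SteinerTree G S) λ T →
    ∀ i j → i ≢ j → ∀ u v →
      edges (tree (T i)) u v ≡ true → edges (tree (T j)) u v ≡ false

LambdaIs : ∀ {n} → Graph n → Subset n → ℕ → Set
LambdaIs G S t = HasDisjointTrees G S t × (∀ t′ → HasDisjointTrees G S t′ → t′ ≤ t)

-- λ_k(G) = c : c is the minimum of λ(S) over all S with |S| = k
-- (for disconnected G this minimum is 0 whenever 2 ≤ k ≤ n, matching the convention)
LambdaKIs : ∀ {n} → Graph n → ℕ → ℕ → Set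
LambdaKIs {n} G k c =
  (∀ (S : Subset n) → ∣ S ∣ ≡ k → ∀ t → LambdaIs G S t → c ≤ t) ×
  Σ (Subset n) (λ S → (∣ S ∣ ≡ k) × LambdaIs G S c)

module Submission where

-- Write c = ⌊2m/n⌋, so c ≤ λ(S) for every k-set S. Given t edge-disjoint S-Steiner trees and
-- u ∈ S, every tree has an edge at u and no two trees share one, so t ≤ d(u); taking S ∋ u with
-- |S| ≥ 2 gives δ(G) ≥ c. If uv is an edge and u, v, w ∈ S, one of u, v meets t + 1 distinct
-- edges: if no tree uses uv, then uv comes on top of the t tree edges at u; otherwise the tree
-- using uv must leave {u, v} to reach w, say at u, and then every tree has an edge at u other
-- than uv. So d(u) = d(v) = c would give c < c. As the degree sum 2m is less than n(c + 1),
-- some vertex has degree c; if n ∣ 2m then G is c-regular, and c > 0 since m ≥ n − 1 > 0, so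
-- that vertex would have a neighbour of the same degree.

open import Data.Bool using (Bool; true; false; if_then_else_; _∧_; T)
open import Data.Bool.Properties using () renaming (_≟_ to _≟ᵇ_)
open import Data.Fin using (Fin; zero; suc; toℕ)
open import Data.Fin.Properties using (_≟_; suc-injective; 0≢1+n; any?; toℕ-injective)
open import Data.Fin.Subset using (Subset; _∈_; ∣_∣; _∪_; _⊆_; ⁅_⁆; ⊤; inside; outside)
open import Data.Fin.Subset.Properties using (∈⊤; ∣⊤∣≡n; ∣⁅x⁆∣≡1; x∈⁅x⁆; p⊆p∪q; q⊆p∪q)
open import Data.List using (map; allFin; tabulate)
open import Data.List.Properties using (map-tabulate)
open import Data.Nat
  using (ℕ; zero; suc; _+_; _*_; _∸_; _≤_; _<_; _≮_; z≤n; s≤s; _<ᵇ_; _≤?_; _⊔_; pred; NonZero; >-nonZero)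
open import Data.Nat.Divisibility using (_∣_)
open import Data.Nat.DivMod using (_/_; _%_; m≡m%n+[m/n]*n; m%n<n; m/n*n≡m)
open import Data.Nat.ListAction using (sum)
open import Data.Nat.Properties
  using ( +-0-commutativeMonoid; module ≤-Reasoning; ≤-trans; ≤-reflexive; ≤-antisym; <-asym; <-irrefl
        ; +-identityʳ; +-suc; *-comm; +-mono-≤; +-monoʳ-≤; +-monoˡ-<; +-mono-<-≤; +-mono-≤-<
        ; n≤1+n; m≤m+n; ≰⇒>; ≮⇒≥; <⇒≱; <⇒≢; ≤∧≢⇒<; m<1+n⇒m≤n; n≢0⇒n>0; ∸-monoˡ-≤
        ; m≤m⊔n; m≤n⊔m; ⊔-idem; suc[m]≤n⇒m≤pred[n]; m≤pred[n]⇒suc[m]≤n; <ᵇ⇒<; <⇒<ᵇ )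
  renaming (_≟_ to _≟ℕ_)
open import Algebra.Properties.CommutativeMonoid.Sum +-0-commutativeMonoid
  using (sum-syntax; ∑-distrib-+; ∑-comm; sum-cong-≗)
open import Data.Product using (_×_; ∃; ∃₂; _,_; proj₁; proj₂)
open import Data.Sum using (_⊎_; inj₁; inj₂)
open import Data.Unit using (tt)
open import Data.Vec using ([]; _∷_; here; there)
open import Defs hiding (sym)
open import Function using (_∘_; Injective)
open import Relation.Binary.PropositionalEquality using (_≡_; _≢_; refl; sym; trans; cong; cong₂; subst; subst₂; module ≡-Reasoning)
open import Relation.Nullary using (¬_; yes; no; contradiction)
open import Relation.Nullary.Decidable using (does; decidable-stable; ¬¬-excluded-middle)

indicator : Bool → ℕ
indicator b = if b then 1 else 0

sum-tabulate : ∀ {n} (f : Fin n → ℕ) → sum (tabulate f) ≡ ∑[ i < n ] f i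
sum-tabulate {zero}  f = refl
sum-tabulate {suc n} f = cong (f zero +_) (sum-tabulate (f ∘ suc))

sum-map-allFin : ∀ n (f : Fin n → ℕ) → sum (map f (allFin n)) ≡ ∑[ i < n ] f i
sum-map-allFin n f = trans (cong sum (map-tabulate (λ i → i) f)) (sum-tabulate f)

count≡∑ : ∀ {n} (p : Fin n → Bool) → count p ≡ ∑[ i < n ] indicator (p i)
count≡∑ {n} p = sum-map-allFin n (indicator ∘ p)

count-suc : ∀ {n} (p : Fin (suc n) → Bool) → count p ≡ indicator (p zero) + count (p ∘ suc)
count-suc p = trans (count≡∑ p) (cong (indicator (p zero) +_) (sym (count≡∑ (p ∘ suc))))

_-[_] : ∀ {n} → (Fin n → Bool) → Fin n → (Fin n → Bool)
(p -[ x ]) y = if does (y ≟ x) then false else p y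

count-remove : ∀ {n} (p : Fin n → Bool) {x} → p x ≡ true → count p ≡ suc (count (p -[ x ]))
count-remove {suc n} p {zero} px = begin
  count p                                ≡⟨ count-suc p ⟩
  indicator (p zero) + count (p ∘ suc)   ≡⟨ cong (λ b → indicator b + count (p ∘ suc)) px ⟩
  suc (count (p ∘ suc))                  ≡⟨ cong suc (count-suc (p -[ zero ])) ⟨
  suc (count (p -[ zero ]))              ∎
  where open ≡-Reasoning
count-remove {suc n} p {suc x} px = begin
  count p                                              ≡⟨ count-suc p ⟩
  indicator (p zero) + count (p ∘ suc)                 ≡⟨ cong (indicator (p zero) +_) (count-remove (p ∘ suc) px) ⟩
  indicator (p zero) + suc (count ((p ∘ suc) -[ x ]))  ≡⟨ +-suc (indicator (p zero)) _ ⟩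
  suc (indicator (p zero) + count ((p ∘ suc) -[ x ]))  ≡⟨ cong suc (count-suc (p -[ suc x ])) ⟨
  suc (count (p -[ suc x ]))                           ∎
  where open ≡-Reasoning

count-injective : ∀ {n t} (p : Fin n → Bool) (f : Fin t → Fin n) →
                  Injective _≡_ _≡_ f → (∀ i → p (f i) ≡ true) → t ≤ count p
count-injective {t = zero}  p f _   _  = z≤n
count-injective {t = suc t} p f inj pf = begin
  suc t                        ≤⟨ s≤s (count-injective (p -[ f zero ]) (f ∘ suc) (suc-injective ∘ inj) pf′) ⟩
  suc (count (p -[ f zero ]))  ≡⟨ count-remove p (pf zero) ⟨
  count p                      ∎
  where
  open ≤-Reasoning
  pf′ : ∀ i → (p -[ f zero ]) (f (suc i)) ≡ true
  pf′ i with f (suc i) ≟ f zero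
  ... | yes f[1+i]≡f[0] = contradiction (inj f[1+i]≡f[0]) (0≢1+n ∘ sym)
  ... | no _            = pf (suc i)

count-witness : ∀ {n} (p : Fin n → Bool) → 0 < count p → ∃ λ x → p x ≡ true
count-witness {suc n} p 0<count rewrite count-suc p with p zero in p0
... | true  = zero , p0
... | false with x , px ← count-witness (p ∘ suc) 0<count = suc x , px

n*c≤∑ : ∀ {n c} (f : Fin n → ℕ) → (∀ i → c ≤ f i) → n * c ≤ ∑[ i < n ] f i
n*c≤∑ {zero}  f _   = z≤n
n*c≤∑ {suc n} f c≤f = +-mono-≤ (c≤f zero) (n*c≤∑ (f ∘ suc) (c≤f ∘ suc))

n*c<∑ : ∀ {n c} (f : Fin n → ℕ) → (∀ i → c ≤ f i) → ∀ j → c < f j → n * c < ∑[ i < n ] f i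
n*c<∑ {suc n} f c≤f zero    c<fⱼ = +-mono-<-≤ c<fⱼ (n*c≤∑ (f ∘ suc) (c≤f ∘ suc))
n*c<∑ {suc n} f c≤f (suc j) c<fⱼ = +-mono-≤-< (c≤f zero) (n*c<∑ (f ∘ suc) (c≤f ∘ suc) j c<fⱼ)

∑<n*[1+c]⇒∃≤ : ∀ {n c} (f : Fin n → ℕ) → ∑[ i < n ] f i < n * suc c → ∃ λ i → f i ≤ c
∑<n*[1+c]⇒∃≤ {n} {c} f ∑<n*[1+c] with any? (λ i → f i ≤? c)
... | yes f≤c = f≤c
... | no  f≰c = contradiction (n*c≤∑ f λ i → ≰⇒> λ fᵢ≤c → f≰c (i , fᵢ≤c)) (<⇒≱ ∑<n*[1+c])

∑≤n*c⇒≡ : ∀ {n c} (f : Fin n → ℕ) → (∀ i → c ≤ f i) → ∑[ i < n ] f i ≤ n * c → ∀ j → f j ≡ c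
∑≤n*c⇒≡ f c≤f ∑≤n*c j with f j ≟ℕ _
... | yes fⱼ≡c = fⱼ≡c
... | no  fⱼ≢c = contradiction ∑≤n*c (<⇒≱ (n*c<∑ f c≤f j (≤∧≢⇒< (c≤f j) (fⱼ≢c ∘ sym))))

∣p∪q∣≤∣p∣+∣q∣ : ∀ {n} (p q : Subset n) → ∣ p ∪ q ∣ ≤ ∣ p ∣ + ∣ q ∣
∣p∪q∣≤∣p∣+∣q∣ []            []            = z≤n
∣p∪q∣≤∣p∣+∣q∣ (outside ∷ p) (outside ∷ q) = ∣p∪q∣≤∣p∣+∣q∣ p q
∣p∪q∣≤∣p∣+∣q∣ (outside ∷ p) (inside  ∷ q) =
  ≤-trans (s≤s (∣p∪q∣≤∣p∣+∣q∣ p q)) (≤-reflexive (sym (+-suc ∣ p ∣ ∣ q ∣)))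
∣p∪q∣≤∣p∣+∣q∣ (inside  ∷ p) (outside ∷ q) = s≤s (∣p∪q∣≤∣p∣+∣q∣ p q)
∣p∪q∣≤∣p∣+∣q∣ (inside  ∷ p) (inside  ∷ q) =
  s≤s (≤-trans (∣p∪q∣≤∣p∣+∣q∣ p q) (+-monoʳ-≤ ∣ p ∣ (n≤1+n ∣ q ∣)))

∣⁅x⁆∪⁅y⁆∪⁅z⁆∣≤3 : ∀ {n} (x y z : Fin n) → ∣ ⁅ x ⁆ ∪ (⁅ y ⁆ ∪ ⁅ z ⁆) ∣ ≤ 3
∣⁅x⁆∪⁅y⁆∪⁅z⁆∣≤3 x y z = begin
  ∣ ⁅ x ⁆ ∪ (⁅ y ⁆ ∪ ⁅ z ⁆) ∣          ≤⟨ ∣p∪q∣≤∣p∣+∣q∣ ⁅ x ⁆ _ ⟩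
  ∣ ⁅ x ⁆ ∣ + ∣ ⁅ y ⁆ ∪ ⁅ z ⁆ ∣        ≤⟨ +-monoʳ-≤ ∣ ⁅ x ⁆ ∣ (∣p∪q∣≤∣p∣+∣q∣ ⁅ y ⁆ ⁅ z ⁆) ⟩
  ∣ ⁅ x ⁆ ∣ + (∣ ⁅ y ⁆ ∣ + ∣ ⁅ z ⁆ ∣)  ≡⟨ cong₂ _+_ (∣⁅x⁆∣≡1 x) (cong₂ _+_ (∣⁅x⁆∣≡1 y) (∣⁅x⁆∣≡1 z)) ⟩
  3                                   ∎
  where open ≤-Reasoning

∷-⊆ : ∀ {n} {p q : Subset n} s → p ⊆ q → s ∷ p ⊆ s ∷ q
∷-⊆ inside p⊆q here        = here
∷-⊆ _      p⊆q (there x∈p) = there (p⊆q x∈p)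

⊆-ofSize : ∀ {n} k (p : Subset n) → ∣ p ∣ ≤ k → k ≤ n → ∃ λ q → p ⊆ q × ∣ q ∣ ≡ k
⊆-ofSize zero    []            _         _         = [] , (λ ()) , refl
⊆-ofSize (suc k) (inside  ∷ p) (s≤s p≤k) (s≤s k≤n)
  with q , p⊆q , ∣q∣≡k ← ⊆-ofSize k p p≤k k≤n = inside ∷ q , ∷-⊆ inside p⊆q , cong suc ∣q∣≡k
⊆-ofSize {suc n} k (outside ∷ p) p≤k k≤1+n with k ≤? n
... | yes k≤n with q , p⊆q , ∣q∣≡k ← ⊆-ofSize k p p≤k k≤n = outside ∷ q , ∷-⊆ outside p⊆q , ∣q∣≡k
... | no  k≰n = ⊤ , (λ _ → ∈⊤) , trans (∣⊤∣≡n (suc n)) (≤-antisym (≰⇒> k≰n) k≤1+n)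

∃-ofSize-∋₃ : ∀ {n} k (u v w : Fin n) → 3 ≤ k → k ≤ n → ∃ λ S → ∣ S ∣ ≡ k × u ∈ S × v ∈ S × w ∈ S
∃-ofSize-∋₃ k u v w 3≤k k≤n
  with S , uvw⊆S , ∣S∣≡k ← ⊆-ofSize k (⁅ u ⁆ ∪ (⁅ v ⁆ ∪ ⁅ w ⁆)) (≤-trans (∣⁅x⁆∪⁅y⁆∪⁅z⁆∣≤3 u v w) 3≤k) k≤n
  = S , ∣S∣≡k
  , uvw⊆S (p⊆p∪q _ (x∈⁅x⁆ u))
  , uvw⊆S (q⊆p∪q ⁅ u ⁆ _ (p⊆p∪q ⁅ w ⁆ (x∈⁅x⁆ v)))
  , uvw⊆S (q⊆p∪q ⁅ u ⁆ _ (q⊆p∪q ⁅ v ⁆ ⁅ w ⁆ (x∈⁅x⁆ w)))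

∃-≢₂ : ∀ {n} → 3 ≤ n → (a b : Fin n) → ∃ λ w → w ≢ a × w ≢ b
∃-≢₂ (s≤s (s≤s (s≤s _))) zero          zero          = suc zero , (λ ()) , (λ ())
∃-≢₂ (s≤s (s≤s (s≤s _))) zero          (suc zero)    = suc (suc zero) , (λ ()) , (λ ())
∃-≢₂ (s≤s (s≤s (s≤s _))) zero          (suc (suc _)) = suc zero , (λ ()) , (λ ())
∃-≢₂ (s≤s (s≤s (s≤s _))) (suc zero)    zero          = suc (suc zero) , (λ ()) , (λ ())
∃-≢₂ (s≤s (s≤s (s≤s _))) (suc zero)    (suc _)       = zero , (λ ()) , (λ ())
∃-≢₂ (s≤s (s≤s (s≤s _))) (suc (suc _)) zero          = suc zero , (λ ()) , (λ ())
∃-≢₂ (s≤s (s≤s (s≤s _))) (suc (suc _)) (suc _)       = zero , (λ ()) , (λ ())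

IsMaximum : (ℕ → Set) → ℕ → Set
IsMaximum P t = P t × (∀ t′ → P t′ → t′ ≤ t)

¬¬-maximumBelow : ∀ {P : ℕ → Set} → P 0 → ∀ j → ¬ ¬ (∃ λ t → P t × (∀ t′ → P t′ → t′ < j → t′ ≤ t))
¬¬-maximumBelow P0 zero    ¬max = ¬max (0 , P0 , λ _ _ ())
¬¬-maximumBelow P0 (suc j) ¬max = ¬¬-excluded-middle λ
  { (yes Pj) → ¬max (j , Pj , λ _ _ → m<1+n⇒m≤n)
  ; (no ¬Pj) → ¬¬-maximumBelow P0 j λ (t , Pt , max) →
      ¬max (t , Pt , λ t′ Pt′ t′<1+j → max t′ Pt′ (≤∧≢⇒< (m<1+n⇒m≤n t′<1+j) λ { refl → ¬Pj Pt′ }))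
  }

-- A maximum of P need not be constructible, but c ≤ B is decidable, so it is enough that one
-- exists up to double negation.
≤-maximum⇒≤-upperBound : ∀ {P : ℕ → Set} {B c} → P 0 → (∀ t → P t → t ≤ B) →
                          (∀ t → IsMaximum P t → c ≤ t) → c ≤ B
≤-maximum⇒≤-upperBound {B = B} {c} P0 P≤B c≤max = decidable-stable (c ≤? B) λ c≰B →
  ¬¬-maximumBelow P0 (suc B) λ (t , Pt , max) →
    c≰B (≤-trans (c≤max t (Pt , λ t′ Pt′ → max t′ Pt′ (s≤s (P≤B t′ Pt′)))) (P≤B t Pt))

adj⇒≢ : ∀ {n} (G : Graph n) {u v} → adj G u v ≡ true → u ≢ v
adj⇒≢ G {u} uv refl = contradiction (trans (sym uv) (irrefl G u)) λ ()

0<deg : ∀ {n} (G : Graph n) {u v} → adj G u v ≡ true → 0 < deg G u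
0<deg G {u} {v} uv = count-injective (adj G u) (λ _ → v) (λ { {zero} {zero} _ → refl }) (λ _ → uv)

<ᵇ≡true⇒< : ∀ m n → (m <ᵇ n) ≡ true → m < n
<ᵇ≡true⇒< m n m<ᵇn = <ᵇ⇒< m n (subst T (sym m<ᵇn) tt)

<ᵇ≡false⇒≮ : ∀ m n → (m <ᵇ n) ≡ false → m ≮ n
<ᵇ≡false⇒≮ _ _ m<ᵇn m<n = subst T m<ᵇn (<⇒<ᵇ m<n)

indicator-split : ∀ b x y → (b ≡ true → x ≢ y) →
                  indicator b ≡ indicator (b ∧ (x <ᵇ y)) + indicator (b ∧ (y <ᵇ x))
indicator-split false _ _ _ = refl
indicator-split true x y x≢y with x <ᵇ y in x<ᵇy | y <ᵇ x in y<ᵇx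
... | true  | true  = contradiction (<ᵇ≡true⇒< y x y<ᵇx) (<-asym (<ᵇ≡true⇒< x y x<ᵇy))
... | true  | false = refl
... | false | true  = refl
... | false | false = contradiction (≤-antisym (≮⇒≥ (<ᵇ≡false⇒≮ y x y<ᵇx)) (≮⇒≥ (<ᵇ≡false⇒≮ x y x<ᵇy))) (x≢y refl)

∑deg≡2*numEdges : ∀ {n} (G : Graph n) → ∑[ u < n ] deg G u ≡ 2 * numEdges G
∑deg≡2*numEdges {n} G = begin
  ∑[ u < n ] deg G u                                        ≡⟨ sum-cong-≗ {n} (count≡∑ ∘ adj G) ⟩
  ∑[ u < n ] ∑[ v < n ] indicator (adj G u v)               ≡⟨ sum-cong-≗ {n} (λ u → sum-cong-≗ {n} (adj-split u)) ⟩
  ∑[ u < n ] ∑[ v < n ] (below u v + below v u)             ≡⟨ sum-cong-≗ {n} (λ u → ∑-distrib-+ (below u) (λ v → below v u)) ⟩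
  ∑[ u < n ] (∑[ v < n ] below u v + ∑[ v < n ] below v u)  ≡⟨ ∑-distrib-+ {n} _ _ ⟩
  X + ∑[ u < n ] ∑[ v < n ] below v u                       ≡⟨ cong (X +_) (∑-comm below) ⟨
  X + X                                                     ≡⟨ cong (X +_) (+-identityʳ X) ⟨
  2 * X                                                     ≡⟨ cong (2 *_) numEdges≡X ⟨
  2 * numEdges G                                            ∎
  where
  open ≡-Reasoning
  below : Fin n → Fin n → ℕ
  below u v = indicator (adj G u v ∧ (toℕ u <ᵇ toℕ v))
  X : ℕ
  X = ∑[ u < n ] ∑[ v < n ] below u v
  numEdges≡X : numEdges G ≡ X
  numEdges≡X = trans (sum-map-allFin n _) (sum-cong-≗ {n} λ u → count≡∑ (λ v → adj G u v ∧ (toℕ u <ᵇ toℕ v)))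
  adj-split : ∀ u v → indicator (adj G u v) ≡ below u v + below v u
  adj-split u v = trans (indicator-split (adj G u v) (toℕ u) (toℕ v) λ uv → adj⇒≢ G uv ∘ toℕ-injective)
                        (cong (λ b → below u v + indicator (b ∧ (toℕ v <ᵇ toℕ u))) (Graph.sym G u v))

Walk-firstEdge : ∀ {n} {F : EdgeSet n} {a b} → Walk F a b → a ≢ b → ∃ λ y → F a y ≡ true
Walk-firstEdge here               a≢a = contradiction refl a≢a
Walk-firstEdge (step {v = y} e _) _   = y , e

Walk-exitEdge : ∀ {n} {F : EdgeSet n} {a w} (u v : Fin n) → Walk F a w → a ≡ u ⊎ a ≡ v → w ≢ u → w ≢ v →
                ∃₂ λ s y → (s ≡ u ⊎ s ≡ v) × F s y ≡ true × y ≢ u × y ≢ v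
Walk-exitEdge u v here (inj₁ refl) w≢u _ = contradiction refl w≢u
Walk-exitEdge u v here (inj₂ refl) _ w≢v = contradiction refl w≢v
Walk-exitEdge u v (step {v = b} e walk) a∈uv w≢u w≢v with b ≟ u | b ≟ v
... | yes b≡u | _       = Walk-exitEdge u v walk (inj₁ b≡u) w≢u w≢v
... | no _    | yes b≡v = Walk-exitEdge u v walk (inj₂ b≡v) w≢u w≢v
... | no b≢u  | no b≢v  = _ , b , a∈uv , e , b≢u , b≢v

module EdgeDisjointSteinerTrees {n} {G : Graph n} {S : Subset n} {t} (trees : HasDisjointTrees G S t) where

  Tree : Fin t → SteinerTree G S
  Tree = proj₁ trees

  E : Fin t → EdgeSet n
  E i = edges (tree (Tree i))

  walk : ∀ i {u v} → u ∈ S → v ∈ S → Walk (E i) u v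
  walk i {u} {v} u∈S v∈S = connected (tree (Tree i)) u v (contains (Tree i) u u∈S) (contains (Tree i) v v∈S)

  E⇒adj : ∀ i {u v} → E i u v ≡ true → adj G u v ≡ true
  E⇒adj i = edgesSub (tree (Tree i)) _ _

  E-disjoint : ∀ {i j u v} → i ≢ j → E i u v ≡ true → E j u v ≢ true
  E-disjoint {i} {j} {u} {v} i≢j eᵢ eⱼ = contradiction (trans (sym eⱼ) (proj₂ trees i j i≢j u v eᵢ)) λ ()

  E-owner-unique : ∀ {i j u v} → E i u v ≡ true → E j u v ≡ true → i ≡ j
  E-owner-unique {i} {j} eᵢ eⱼ with i ≟ j
  ... | yes i≡j = i≡j
  ... | no  i≢j = contradiction eⱼ (E-disjoint i≢j eᵢ)

  star-injective : ∀ {s} (y : Fin t → Fin n) → (∀ i → E i s (y i) ≡ true) → Injective _≡_ _≡_ y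
  star-injective {s} y sy {i} {j} yᵢ≡yⱼ = E-owner-unique (sy i) (subst (λ z → E j s z ≡ true) (sym yᵢ≡yⱼ) (sy j))

  t≤deg : ∀ {s} → (∀ i → ∃ λ y → E i s y ≡ true) → t ≤ deg G s
  t≤deg star = count-injective _ (proj₁ ∘ star) (star-injective _ (proj₂ ∘ star)) (λ i → E⇒adj i (proj₂ (star i)))

  1+t≤deg : ∀ {s r} → adj G s r ≡ true → (∀ i → ∃ λ y → E i s y ≡ true × y ≢ r) → suc t ≤ deg G s
  1+t≤deg {s} {r} sr star = count-injective _ y injective adjacent
    where
    y : Fin (suc t) → Fin n
    y zero    = r
    y (suc i) = proj₁ (star i)
    injective : Injective _≡_ _≡_ y
    injective {zero}  {zero}  _     = refl
    injective {zero}  {suc j} r≡yⱼ  = contradiction (sym r≡yⱼ) (proj₂ (proj₂ (star j)))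
    injective {suc i} {zero}  yᵢ≡r  = contradiction yᵢ≡r (proj₂ (proj₂ (star i)))
    injective {suc i} {suc j} yᵢ≡yⱼ = cong suc (star-injective (y ∘ suc) (proj₁ ∘ proj₂ ∘ star) yᵢ≡yⱼ)
    adjacent : ∀ i → adj G s (y i) ≡ true
    adjacent zero    = sr
    adjacent (suc i) = E⇒adj i (proj₁ (proj₂ (star i)))

  t≤deg-of-∈ : ∀ {u w} → u ∈ S → w ∈ S → u ≢ w → t ≤ deg G u
  t≤deg-of-∈ u∈S w∈S u≢w = t≤deg λ i → Walk-firstEdge (walk i u∈S w∈S) u≢w

  firstEdge-avoiding : ∀ i {s r} → s ∈ S → r ∈ S → s ≢ r → E i s r ≢ true → ∃ λ y → E i s y ≡ true × y ≢ r
  firstEdge-avoiding i s∈S r∈S s≢r sr∉Eᵢ with y , sy ← Walk-firstEdge (walk i s∈S r∈S) s≢r =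
    y , sy , λ { refl → sr∉Eᵢ sy }

  -- Trees other than i₀ cannot use sr, so every tree has an edge at s avoiding r.
  1+t≤deg-branching : ∀ {i₀ s r y} → s ∈ S → r ∈ S → E i₀ s r ≡ true → E i₀ s y ≡ true → y ≢ r →
                      suc t ≤ deg G s
  1+t≤deg-branching {i₀} {s} {r} s∈S r∈S sr sy y≢r = 1+t≤deg (E⇒adj i₀ sr) star
    where
    star : ∀ i → ∃ λ y → E i s y ≡ true × y ≢ r
    star i with i ≟ i₀
    ... | yes refl = _ , sy , y≢r
    ... | no i≢i₀  = firstEdge-avoiding i s∈S r∈S (adj⇒≢ G (E⇒adj i₀ sr)) (E-disjoint (i≢i₀ ∘ sym) sr)

  -- If some tree uses uv, its path to w leaves {u, v} through a second edge at u or at v.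
  1+t≤deg-at-edge : ∀ {u v w} → u ∈ S → v ∈ S → w ∈ S → adj G u v ≡ true → w ≢ u → w ≢ v →
                    suc t ≤ deg G u ⊎ suc t ≤ deg G v
  1+t≤deg-at-edge {u} {v} u∈S v∈S w∈S uv w≢u w≢v with any? (λ i → E i u v ≟ᵇ true)
  ... | no unused = inj₁ (1+t≤deg uv λ i → firstEdge-avoiding i u∈S v∈S (adj⇒≢ G uv) λ e → unused (i , e))
  ... | yes (i₀ , e₀) with Walk-exitEdge u v (walk i₀ u∈S w∈S) (inj₁ refl) w≢u w≢v
  ...   | _ , _ , inj₁ refl , sy , _   , y≢v = inj₁ (1+t≤deg-branching u∈S v∈S e₀ sy y≢v)
  ...   | _ , _ , inj₂ refl , sy , y≢u , _   =
          inj₂ (1+t≤deg-branching v∈S u∈S (trans (edgesSym (tree (Tree i₀)) v u) e₀) sy y≢u)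

noTrees : ∀ {n} (G : Graph n) (S : Subset n) → HasDisjointTrees G S 0
noTrees G S = (λ ()) , (λ ())

module _ {n} {G : Graph n} {S : Subset n} {c} (c≤λ : ∀ t → LambdaIs G S t → c ≤ t) where

  ≤λ⇒≤deg : ∀ {u w} → u ∈ S → w ∈ S → u ≢ w → c ≤ deg G u
  ≤λ⇒≤deg u∈S w∈S u≢w = ≤-maximum⇒≤-upperBound (noTrees G S)
    (λ t trees → EdgeDisjointSteinerTrees.t≤deg-of-∈ trees u∈S w∈S u≢w) c≤λ

  ≤λ⇒<deg⊔deg : ∀ {u v w} → u ∈ S → v ∈ S → w ∈ S → adj G u v ≡ true → w ≢ u → w ≢ v →
                c < deg G u ⊔ deg G v
  ≤λ⇒<deg⊔deg {u} {v} u∈S v∈S w∈S uv w≢u w≢v =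
    m≤pred[n]⇒suc[m]≤n {{>-nonZero 0<d}} (≤-maximum⇒≤-upperBound (noTrees G S) t≤pred-d c≤λ)
    where
    d : ℕ
    d = deg G u ⊔ deg G v
    0<d : 0 < d
    0<d = ≤-trans (0<deg G uv) (m≤m⊔n (deg G u) (deg G v))
    t≤pred-d : ∀ t → HasDisjointTrees G S t → t ≤ pred d
    t≤pred-d t trees with EdgeDisjointSteinerTrees.1+t≤deg-at-edge trees u∈S v∈S w∈S uv w≢u w≢v
    ... | inj₁ t<deg-u = suc[m]≤n⇒m≤pred[n] (≤-trans t<deg-u (m≤m⊔n (deg G u) (deg G v)))
    ... | inj₂ t<deg-v = suc[m]≤n⇒m≤pred[n] (≤-trans t<deg-v (m≤n⊔m (deg G u) (deg G v)))

module _ {n} {G : Graph n} {k c} (3≤k : 3 ≤ k) (k≤n : k ≤ n)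
         (c≤λₖ : ∀ S → ∣ S ∣ ≡ k → ∀ t → LambdaIs G S t → c ≤ t) where

  ≤λₖ⇒≤deg : ∀ u → c ≤ deg G u
  ≤λₖ⇒≤deg u with w , w≢u , _ ← ∃-≢₂ (≤-trans 3≤k k≤n) u u
             with S , ∣S∣≡k , u∈S , w∈S , _ ← ∃-ofSize-∋₃ k u w w 3≤k k≤n
    = ≤λ⇒≤deg (c≤λₖ S ∣S∣≡k) u∈S w∈S (w≢u ∘ sym)

  ≤λₖ⇒nonadjacent : ∀ u v → deg G u ≡ c → deg G v ≡ c → adj G u v ≡ false
  ≤λₖ⇒nonadjacent u v deg-u≡c deg-v≡c with adj G u v in uv
  ... | false = refl
  ... | true with w , w≢u , w≢v ← ∃-≢₂ (≤-trans 3≤k k≤n) u v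
             with S , ∣S∣≡k , u∈S , v∈S , w∈S ← ∃-ofSize-∋₃ k u v w 3≤k k≤n
    = contradiction (subst (c <_) (⊔-idem c) (subst₂ (λ a b → c < a ⊔ b) deg-u≡c deg-v≡c
                      (≤λ⇒<deg⊔deg (c≤λₖ S ∣S∣≡k) u∈S v∈S w∈S uv w≢u w≢v)))
                    (<-irrefl refl)

m<n*[1+m/n] : ∀ m n .{{_ : NonZero n}} → m < n * suc (m / n)
m<n*[1+m/n] m n = begin-strict
  m                    ≡⟨ m≡m%n+[m/n]*n m n ⟩
  m % n + (m / n) * n  <⟨ +-monoˡ-< ((m / n) * n) (m%n<n m n) ⟩
  n + (m / n) * n      ≡⟨ *-comm (suc (m / n)) n ⟩
  n * suc (m / n)      ∎
  where open ≤-Reasoning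

n∣m⇒0<m⇒0<m/n : ∀ {m n} .{{_ : NonZero n}} → n ∣ m → 0 < m → 0 < m / n
n∣m⇒0<m⇒0<m/n {m} {n} n∣m 0<m = n≢0⇒n>0 λ m/n≡0 → <⇒≢ 0<m (begin
  0          ≡⟨ cong (_* n) m/n≡0 ⟨
  m / n * n  ≡⟨ m/n*n≡m n∣m ⟩
  m          ∎)
  where open ≡-Reasoning

⌊avgDeg⌋ : ∀ {n} .{{_ : NonZero n}} → Graph n → ℕ
⌊avgDeg⌋ {n} G = (2 * numEdges G) / n

module _ {n} .{{_ : NonZero n}} (G : Graph n) where

  ∃deg≤⌊avgDeg⌋ : ∃ λ u → deg G u ≤ ⌊avgDeg⌋ G
  ∃deg≤⌊avgDeg⌋ = ∑<n*[1+c]⇒∃≤ (deg G) (subst (_< n * suc (⌊avgDeg⌋ G)) (sym (∑deg≡2*numEdges G))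
                                              (m<n*[1+m/n] (2 * numEdges G) n))

  ⌊avgDeg⌋≤δ⇒regular : n ∣ 2 * numEdges G → (∀ u → ⌊avgDeg⌋ G ≤ deg G u) → ∀ u → deg G u ≡ ⌊avgDeg⌋ G
  ⌊avgDeg⌋≤δ⇒regular n∣2e c≤deg = ∑≤n*c⇒≡ (deg G) c≤deg (≤-reflexive (begin
    ∑[ u < n ] deg G u    ≡⟨ ∑deg≡2*numEdges G ⟩
    2 * numEdges G        ≡⟨ m/n*n≡m n∣2e ⟨
    ⌊avgDeg⌋ G * n        ≡⟨ *-comm (⌊avgDeg⌋ G) n ⟩
    n * ⌊avgDeg⌋ G        ∎))
    where open ≡-Reasoning

proposition6 : (n : ℕ) .{{_ : NonZero n}} (G : Graph n) (m k : ℕ) →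
    numEdges G ≡ m → n ∸ 1 ≤ m → 3 ≤ k → k ≤ n →
    LambdaKIs G k ((2 * m) / n) →
    (¬ (n ∣ 2 * m)) ×
    MinDegreeIs G ((2 * m) / n) ×
    (∀ u v → deg G u ≡ (2 * m) / n → deg G v ≡ (2 * m) / n → adj G u v ≡ false)
proposition6 n G m k refl n∸1≤m 3≤k k≤n (c≤λₖ , _) = n∤2m , (c≤deg , δ≡c) , ≤λₖ⇒nonadjacent 3≤k k≤n c≤λₖ
  where
  c≤deg : ∀ u → ⌊avgDeg⌋ G ≤ deg G u
  c≤deg = ≤λₖ⇒≤deg 3≤k k≤n c≤λₖ

  δ≡c : ∃ λ u → deg G u ≡ ⌊avgDeg⌋ G
  δ≡c with u , deg≤c ← ∃deg≤⌊avgDeg⌋ G = u , ≤-antisym deg≤c (c≤deg u)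

  0<2m : 0 < 2 * m
  0<2m = begin-strict
    0        <⟨ s≤s z≤n ⟩
    3 ∸ 1    ≤⟨ ∸-monoˡ-≤ 1 (≤-trans 3≤k k≤n) ⟩
    n ∸ 1    ≤⟨ n∸1≤m ⟩
    m        ≤⟨ m≤m+n m (m + 0) ⟩
    2 * m    ∎
    where open ≤-Reasoning

  n∤2m : ¬ (n ∣ 2 * m)
  n∤2m n∣2m = contradiction (trans (sym uv) (≤λₖ⇒nonadjacent 3≤k k≤n c≤λₖ u v (regular u) (regular v))) λ ()
    where
    regular : ∀ u → deg G u ≡ ⌊avgDeg⌋ G
    regular = ⌊avgDeg⌋≤δ⇒regular G n∣2m c≤deg
    u : Fin n
    u = proj₁ δ≡c
    neighbour : ∃ λ v → adj G u v ≡ true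
    neighbour = count-witness (adj G u) (subst (0 <_) (sym (regular u)) (n∣m⇒0<m⇒0<m/n n∣2m 0<2m))
    v : Fin n
    v = proj₁ neighbour
    uv : adj G u v ≡ true
    uv = proj₂ neighbour
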